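{- Let $k\ge1$ be an integer, let $G$ be a connected graph, $w\colon V(G)\to\mathbb{Q}_{>0}$, and let $\mathcal{P}_k(G,w)$ be the convex hull of all $x\in\{0,1\}^{V(G)\times[k]}$ satisfying (a) $\sum_{v\in V(G)} w(v)\,x_{v,i}\le \sum_{v\in V(G)} w(v)\,x_{v,i+1}$ for all $i\in[k-1]$; (b) $\sum_{i\in[k]} x_{v,i}\le 1$ for all $v\in V(G)$; (c) $x_{u,i}+x_{v,i}-\sum_{z\in S}x_{z,i}\le 1$ for every pair of distinct non-adjacent vertices $u,v$, every minimal $(u,v)$-separator $S$, and every $i\in[k]$. Let $q\ge 2$ be an integer, let $S\subseteq V(G)$, let $N(S)$ be the set of neighbors of $S$, and let $S'\subseteq S$ contain $q$ distinct pairs of vertices $\{s_i,t_i\}$ with $s_i\ne t_i$, $i\in[q]$. Let $\sigma\colon[q]\to[k]$ be injective with image $I=\{\sigma(i)\colon i\in[q]\}$. If there is no collection of $q$ pairwise vertex-disjoint paths $P_1,\dots,P_q$ in $G[S]$ with $P_i$ an $(s_i,t_i)$-path for each $i$, then the inequality $$\sum_{i\in[q]}\big(x_{s_i,\sigma(i)}+x_{t_i,\sigma(i)}\big)+\sum_{v\in N(S)}\sum_{i\in[k]\setminus I}x_{v,i}\le 2q+|N(S)|-1$$ is valid for $\mathcal{P}_k(G,w)$.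
   Context: $[k]=\{1,\dots,k\}$. For non-adjacent vertices $u,v$, a $(u,v)$-separator is a set $S\subseteq V(G)\setminus\{u,v\}$ such that $u,v$ are in different components of $G-S$; minimal means inclusion-minimal. $N(S)$ denotes the set of vertices not in $S$ that are adjacent to some vertex of $S$. An inequality is valid for a polytope if every point of it satisfies the inequality.
   Formalization: The polytope $\mathcal{P}_k(G,w)$ is taken over ℚ: validity is required only at points that are convex combinations of the feasible 0/1 vectors with rational weights. -}

module Defs where

open import Data.Bool using (Bool; true; false; _∨_; _∧_; not; if_then_else_)
open import Data.Nat as ℕ using (ℕ; zero; suc)
open import Data.Fin using (Fin; toℕ; _≟_)
open import Data.List using (List; []; _∷_)
open import Data.List.Relation.Unary.All using (All)
open import Data.List.Relation.Unary.Unique.Propositional using (Unique)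
open import Data.List.Membership.Propositional using (_∈_)
open import Data.Product using (Σ; _×_; _,_; ∃)
open import Data.Empty using (⊥)
open import Relation.Nullary using (¬_)
open import Relation.Nullary.Decidable using (⌊_⌋)
open import Relation.Binary.PropositionalEquality using (_≡_; _≢_)
open import Data.Rational using (ℚ; 0ℚ; 1ℚ; _+_; _-_; _*_; _≤_; _<_; _/_)
open import Data.Integer using (+_)

sumFin : (n : ℕ) → (Fin n → ℚ) → ℚ
sumFin zero    f = 0ℚ
sumFin (suc n) f = f Data.Fin.zero + sumFin n (λ i → f (Data.Fin.suc i))

anyFin : (n : ℕ) → (Fin n → Bool) → Bool
anyFin zero    f = false
anyFin (suc n) f = f Data.Fin.zero ∨ anyFin n (λ i → f (Data.Fin.suc i))

countFin : (n : ℕ) → (Fin n → Bool) → ℕ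
countFin zero    f = zero
countFin (suc n) f =
  (if f Data.Fin.zero then 1 else 0) ℕ.+ countFin n (λ i → f (Data.Fin.suc i))

bℚ : Bool → ℚ
bℚ true  = 1ℚ
bℚ false = 0ℚ

ℕtoℚ : ℕ → ℚ
ℕtoℚ m = (+ m) / 1

record Graph (n : ℕ) : Set where
  field
    adj     : Fin n → Fin n → Bool
    symm    : ∀ u v → adj u v ≡ adj v u
    irrefl  : ∀ v → adj v v ≡ false

open Graph public

VSet : ℕ → Set
VSet n = Fin n → Bool

module _ {n : ℕ} (G : Graph n) where

  -- Chain u v ws : u ∷ ws is a walk from u ending at v
  Chain : Fin n → Fin n → List (Fin n) → Set
  Chain u v []       = u ≡ v
  Chain u v (w ∷ ws) = adj G u w ≡ true × Chain w v ws

  Connected : Set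
  Connected = ∀ u v → ∃ λ ws → Chain u v ws

  IsSeparator : Fin n → Fin n → VSet n → Set
  IsSeparator u v S =
    S u ≡ false × S v ≡ false ×
    ¬ (∃ λ ws → Chain u v ws × All (λ z → S z ≡ false) ws)

  IsMinimalSeparator : Fin n → Fin n → VSet n → Set
  IsMinimalSeparator u v S =
    IsSeparator u v S ×
    (∀ T → (∀ z → T z ≡ true → S z ≡ true) → IsSeparator u v T →
       ∀ z → S z ≡ true → T z ≡ true)

  IsPathIn : VSet n → Fin n → Fin n → List (Fin n) → Set
  IsPathIn S s t []       = ⊥
  IsPathIn S s t (p ∷ ps) =
    p ≡ s × Chain s t ps × Unique (p ∷ ps) × All (λ z → S z ≡ true) (p ∷ ps)

  nbhd : VSet n → VSet n
  nbhd S v = not (S v) ∧ anyFin n (λ z → S z ∧ adj G z v)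

module _ {n : ℕ} (G : Graph n) (k : ℕ) (w : Fin n → ℚ) where

  BinPoint : Set
  BinPoint = Fin n → Fin k → Bool

  Point : Set
  Point = Fin n → Fin k → ℚ

  Feasible : BinPoint → Set
  Feasible y =
    (∀ (i j : Fin k) → toℕ j ≡ suc (toℕ i) →
       sumFin n (λ v → w v * bℚ (y v i)) ≤ sumFin n (λ v → w v * bℚ (y v j))) ×
    (∀ v → sumFin k (λ i → bℚ (y v i)) ≤ 1ℚ) ×
    (∀ u v → u ≢ v → adj G u v ≡ false → ∀ S → IsMinimalSeparator G u v S →
       ∀ i → (bℚ (y u i) + bℚ (y v i)) - sumFin n (λ z → bℚ (S z ∧ y z i)) ≤ 1ℚ)

  sumList : List (ℚ × BinPoint) → (ℚ → BinPoint → ℚ) → ℚ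
  sumList []             f = 0ℚ
  sumList ((l , y) ∷ cs) f = f l y + sumList cs f

  InHull : Point → Set
  InHull x = Σ (List (ℚ × BinPoint)) λ cs →
    All (λ c → 0ℚ ≤ Data.Product.proj₁ c × Feasible (Data.Product.proj₂ c)) cs ×
    sumList cs (λ l _ → l) ≡ 1ℚ ×
    (∀ v i → x v i ≡ sumList cs (λ l y → l * bℚ (y v i)))

  ValidFor : (Point → ℚ) → ℚ → Set
  ValidFor lhs rhs = ∀ x → InHull x → lhs x ≤ rhs

-- Validity needs checking only at the feasible 0/1 points, the left-hand side being linear.
-- There each pair {s_i, t_i} contributes at most 2 and, by (b), each v ∈ N(S) at most 1,
-- so a violation forces s_i and t_i into colour class σ(i) and every vertex of N(S) to carry
-- a colour outside I. Colour class σ(i) then avoids N(S), and inequality (c), applied to a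
-- minimal (s_i, t_i)-separator inside the complement of the class, yields an s_i–t_i walk in
-- the class; such a walk cannot leave S. By (b) the classes are disjoint, so shortening the
-- walks to paths gives the q disjoint paths that were assumed not to exist.
module Submission where

open import Defs
open import Level using (0ℓ)
open import Algebra.Bundles using (CommutativeMonoid)
import Algebra.Properties.CommutativeSemigroup as CommSemigroupProperties
open import Data.Bool using (Bool; true; false; not; _∧_)
open import Data.Bool.Properties using (¬-not; not-injective; ∧-zeroʳ)
open import Data.Nat as ℕ using (ℕ; suc; _≥_)
import Data.Nat.Properties as ℕP
open import Data.Nat.Induction using (<-rec)
open import Data.Nat.Coprimality using (1-coprimeTo) renaming (sym to coprime-sym)
import Data.Integer as ℤ
import Data.Integer.Properties as ℤP
open import Data.Fin using (Fin; _≟_)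
import Data.Fin as Fin
open import Data.List using (List; []; _∷_)
open import Data.List.Membership.Propositional using (_∈_)
import Data.List.Membership.DecPropositional as DecMembership
import Data.List.Relation.Binary.Subset.Propositional as List
open import Data.List.Relation.Binary.Subset.Propositional.Properties using (∷⁺ʳ)
open import Data.List.Relation.Unary.All as All using (All; []; _∷_)
open import Data.List.Relation.Unary.All.Properties using (anti-mono; ¬Any⇒All¬)
open import Data.List.Relation.Unary.Any using (here; there)
open import Data.List.Relation.Unary.AllPairs using ([]; _∷_)
open import Data.List.Relation.Unary.Unique.Propositional using (Unique)
open import Data.Product using (Σ; _×_; ∃; _,_; proj₁; proj₂)
open import Data.Empty using (⊥; ⊥-elim)
open import Data.Sum using (_⊎_; inj₁; inj₂)
open import Effect.Monad using (RawMonad)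
open import Function using (_∘_)
open import Relation.Nullary using (¬_; yes; no; contradiction)
open import Relation.Nullary.Decidable using (⌊_⌋; decidable-stable; ¬¬-excluded-middle; dec-true; isYes≗does)
open import Relation.Nullary.Negation using (¬¬-Monad)
open import Relation.Binary.PropositionalEquality
open import Function.Definitions using (Injective)
open import Data.Rational using (ℚ; 0ℚ; 1ℚ; _<_; _+_; _-_; _≤_; _*_; -_; toℚᵘ; nonNegative)
open import Data.Rational.Properties hiding (_≟_)
import Data.Rational.Unnormalised as ℚᵘ
import Data.Rational.Unnormalised.Properties as ℚᵘP

open RawMonad (¬¬-Monad {0ℓ}) using (pure; _>>=_; _<$>_)
open CommSemigroupProperties (CommutativeMonoid.commutativeSemigroup +-0-commutativeMonoid)
  using () renaming (interchange to +-interchange)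
open CommSemigroupProperties (CommutativeMonoid.commutativeSemigroup *-1-commutativeMonoid)
  using () renaming (x∙yz≈y∙xz to *-leftSwap)

¬¬-∀-Fin : ∀ m {P : Fin m → Set} → (∀ i → ¬ ¬ P i) → ¬ ¬ (∀ i → P i)
¬¬-∀-Fin ℕ.zero    ¬¬P = pure λ ()
¬¬-∀-Fin (suc m) ¬¬P = do
  p₀ ← ¬¬P Fin.zero
  ps ← ¬¬-∀-Fin m (¬¬P ∘ Fin.suc)
  pure λ { Fin.zero → p₀ ; (Fin.suc i) → ps i }

-- ≤⇒≤ᵇ lands in T (2 ≤ᵇ 1), which computes to ⊥.
¬2≤1 : ¬ (1ℚ + 1ℚ ≤ 1ℚ)
¬2≤1 = ≤⇒≤ᵇ

0≤bℚ : ∀ b → 0ℚ ≤ bℚ b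
0≤bℚ true  = ≤ᵇ⇒≤ _
0≤bℚ false = ≤-refl

bℚ≤1 : ∀ b → bℚ b ≤ 1ℚ
bℚ≤1 true  = ≤-refl
bℚ≤1 false = ≤ᵇ⇒≤ _

bℚ-+-gap : ∀ a b → a ≡ false ⊎ b ≡ false → (bℚ a + bℚ b) + 1ℚ ≤ 1ℚ + 1ℚ
bℚ-+-gap true  true  (inj₁ ())
bℚ-+-gap true  true  (inj₂ ())
bℚ-+-gap true  false _ = ≤ᵇ⇒≤ _
bℚ-+-gap false true  _ = ≤ᵇ⇒≤ _
bℚ-+-gap false false _ = ≤ᵇ⇒≤ _

+1≤⇒≤-1 : ∀ {p q} → p + 1ℚ ≤ q → p ≤ q - 1ℚ
+1≤⇒≤-1 {p} {q} p+1≤q = ≤-trans (≤-reflexive (sym p+1-1≡p)) (+-monoˡ-≤ (- 1ℚ) p+1≤q)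
  where
  p+1-1≡p : (p + 1ℚ) - 1ℚ ≡ p
  p+1-1≡p = trans (+-assoc p 1ℚ (- 1ℚ)) (trans (cong (p +_) (+-inverseʳ 1ℚ)) (+-identityʳ p))

toℚᵘ-ℕtoℚ : ∀ m → toℚᵘ (ℕtoℚ m) ≡ ℚᵘ.mkℚᵘ (ℤ.+ m) 0
toℚᵘ-ℕtoℚ m = cong toℚᵘ (normalize-coprime (coprime-sym (1-coprimeTo m)))

ℕtoℚ-+ : ∀ a b → ℕtoℚ (a ℕ.+ b) ≡ ℕtoℚ a + ℕtoℚ b
ℕtoℚ-+ a b = toℚᵘ-injective (begin
  toℚᵘ (ℕtoℚ (a ℕ.+ b))                   ≡⟨ toℚᵘ-ℕtoℚ (a ℕ.+ b) ⟩
  ℚᵘ.mkℚᵘ (ℤ.+ (a ℕ.+ b)) 0               ≈⟨ ℚᵘ.*≡* (cong (ℤ._* ℤ.+ 1) +[a+b]≡a*1+b*1) ⟩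
  ℚᵘ.mkℚᵘ (ℤ.+ a) 0 ℚᵘ.+ ℚᵘ.mkℚᵘ (ℤ.+ b) 0 ≡⟨ sym (cong₂ ℚᵘ._+_ (toℚᵘ-ℕtoℚ a) (toℚᵘ-ℕtoℚ b)) ⟩
  toℚᵘ (ℕtoℚ a) ℚᵘ.+ toℚᵘ (ℕtoℚ b)        ≈⟨ ℚᵘP.≃-sym (toℚᵘ-homo-+ (ℕtoℚ a) (ℕtoℚ b)) ⟩
  toℚᵘ (ℕtoℚ a + ℕtoℚ b)                  ∎)
  where
  open ℚᵘP.≃-Reasoning
  +[a+b]≡a*1+b*1 : ℤ.+ (a ℕ.+ b) ≡ ℤ.+ a ℤ.* ℤ.+ 1 ℤ.+ ℤ.+ b ℤ.* ℤ.+ 1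
  +[a+b]≡a*1+b*1 = trans (ℤP.pos-+ a b)
    (sym (cong₂ ℤ._+_ (ℤP.*-identityʳ (ℤ.+ a)) (ℤP.*-identityʳ (ℤ.+ b))))

sumFin-cong : ∀ {m} {f g : Fin m → ℚ} → (∀ j → f j ≡ g j) → sumFin m f ≡ sumFin m g
sumFin-cong {ℕ.zero}  f≡g = refl
sumFin-cong {suc m} f≡g = cong₂ _+_ (f≡g Fin.zero) (sumFin-cong (f≡g ∘ Fin.suc))

sumFin-zero : ∀ {m} {f : Fin m → ℚ} → (∀ j → f j ≡ 0ℚ) → sumFin m f ≡ 0ℚ
sumFin-zero {ℕ.zero}  f≡0 = refl
sumFin-zero {suc m} f≡0 =
  trans (cong₂ _+_ (f≡0 Fin.zero) (sumFin-zero (f≡0 ∘ Fin.suc))) (+-identityˡ 0ℚ)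

sumFin-+ : ∀ {m} (f g : Fin m → ℚ) → sumFin m (λ j → f j + g j) ≡ sumFin m f + sumFin m g
sumFin-+ {ℕ.zero}  f g = sym (+-identityˡ 0ℚ)
sumFin-+ {suc m} f g = trans (cong (f Fin.zero + g Fin.zero +_) (sumFin-+ (f ∘ Fin.suc) (g ∘ Fin.suc)))
  (+-interchange (f Fin.zero) (g Fin.zero) (sumFin m (f ∘ Fin.suc)) (sumFin m (g ∘ Fin.suc)))

sumFin-*ˡ : ∀ {m} c (f : Fin m → ℚ) → sumFin m (λ j → c * f j) ≡ c * sumFin m f
sumFin-*ˡ {ℕ.zero}  c f = sym (*-zeroʳ c)
sumFin-*ˡ {suc m} c f = trans (cong (c * f Fin.zero +_) (sumFin-*ˡ c (f ∘ Fin.suc)))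
  (sym (*-distribˡ-+ c (f Fin.zero) (sumFin m (f ∘ Fin.suc))))

sumFin-mono : ∀ {m} {f g : Fin m → ℚ} → (∀ j → f j ≤ g j) → sumFin m f ≤ sumFin m g
sumFin-mono {ℕ.zero}  f≤g = ≤-refl
sumFin-mono {suc m} f≤g = +-mono-≤ (f≤g Fin.zero) (sumFin-mono (f≤g ∘ Fin.suc))

sumFin-nonNeg : ∀ {m} {f : Fin m → ℚ} → (∀ j → 0ℚ ≤ f j) → 0ℚ ≤ sumFin m f
sumFin-nonNeg {m} 0≤f = ≤-trans (≤-reflexive (sym (sumFin-zero {m} λ _ → refl))) (sumFin-mono 0≤f)

sumFin-mono-+1 : ∀ {m} {f g : Fin m → ℚ} → (∀ j → f j ≤ g j) →
                 ∀ j → f j + 1ℚ ≤ g j → sumFin m f + 1ℚ ≤ sumFin m g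
sumFin-mono-+1 {suc m} {f} {g} f≤g Fin.zero fj+1≤gj = begin
  (f Fin.zero + F) + 1ℚ  ≡⟨ +-assoc (f Fin.zero) F 1ℚ ⟩
  f Fin.zero + (F + 1ℚ)  ≡⟨ cong (f Fin.zero +_) (+-comm F 1ℚ) ⟩
  f Fin.zero + (1ℚ + F)  ≡⟨ sym (+-assoc (f Fin.zero) 1ℚ F) ⟩
  (f Fin.zero + 1ℚ) + F  ≤⟨ +-mono-≤ fj+1≤gj (sumFin-mono (f≤g ∘ Fin.suc)) ⟩
  sumFin (suc m) g       ∎
  where
  open ≤-Reasoning
  F = sumFin m (f ∘ Fin.suc)
sumFin-mono-+1 {suc m} {f} {g} f≤g (Fin.suc j) fj+1≤gj = begin
  (f Fin.zero + F) + 1ℚ  ≡⟨ +-assoc (f Fin.zero) F 1ℚ ⟩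
  f Fin.zero + (F + 1ℚ)  ≤⟨ +-mono-≤ (f≤g Fin.zero) (sumFin-mono-+1 (f≤g ∘ Fin.suc) j fj+1≤gj) ⟩
  sumFin (suc m) g       ∎
  where
  open ≤-Reasoning
  F = sumFin m (f ∘ Fin.suc)

sumFin-1 : ∀ m → sumFin m (λ _ → 1ℚ) ≡ ℕtoℚ m
sumFin-1 ℕ.zero  = refl
sumFin-1 (suc m) = trans (cong (1ℚ +_) (sumFin-1 m)) (sym (ℕtoℚ-+ 1 m))

sumFin-bℚ : ∀ {m} (f : Fin m → Bool) → sumFin m (bℚ ∘ f) ≡ ℕtoℚ (countFin m f)
sumFin-bℚ {ℕ.zero}  f = refl
sumFin-bℚ {suc m} f with f Fin.zero
... | true  = trans (cong (1ℚ +_) (sumFin-bℚ (f ∘ Fin.suc))) (sym (ℕtoℚ-+ 1 (countFin m (f ∘ Fin.suc))))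
... | false = trans (+-identityˡ _) (sumFin-bℚ (f ∘ Fin.suc))

1≤sumFin-bℚ : ∀ {m} (f : Fin m → Bool) {j} → f j ≡ true → 1ℚ ≤ sumFin m (bℚ ∘ f)
1≤sumFin-bℚ {suc m} f {Fin.zero} fj = ≤-trans (≤-reflexive (sym (+-identityʳ 1ℚ)))
  (+-mono-≤ (≤-reflexive (cong bℚ (sym fj))) (sumFin-nonNeg (0≤bℚ ∘ f ∘ Fin.suc)))
1≤sumFin-bℚ {suc m} f {Fin.suc j} fj = ≤-trans (≤-reflexive (sym (+-identityˡ 1ℚ)))
  (+-mono-≤ (0≤bℚ (f Fin.zero)) (1≤sumFin-bℚ (f ∘ Fin.suc) fj))

sumFin-bℚ≤1⇒unique : ∀ {m} (f : Fin m → Bool) → sumFin m (bℚ ∘ f) ≤ 1ℚ →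
                     ∀ {a b} → f a ≡ true → f b ≡ true → a ≡ b
sumFin-bℚ≤1⇒unique {suc m} f Σ≤1 {Fin.zero}  {Fin.zero}  fa fb = refl
sumFin-bℚ≤1⇒unique {suc m} f Σ≤1 {Fin.zero}  {Fin.suc b} fa fb = ⊥-elim (¬2≤1
  (≤-trans (+-mono-≤ (≤-reflexive (cong bℚ (sym fa))) (1≤sumFin-bℚ (f ∘ Fin.suc) fb)) Σ≤1))
sumFin-bℚ≤1⇒unique {suc m} f Σ≤1 {Fin.suc a} {Fin.zero}  fa fb = ⊥-elim (¬2≤1
  (≤-trans (+-mono-≤ (≤-reflexive (cong bℚ (sym fb))) (1≤sumFin-bℚ (f ∘ Fin.suc) fa)) Σ≤1))
sumFin-bℚ≤1⇒unique {suc m} f Σ≤1 {Fin.suc a} {Fin.suc b} fa fb = cong Fin.suc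
  (sumFin-bℚ≤1⇒unique (f ∘ Fin.suc) tail≤1 fa fb)
  where
  tail≤1 : sumFin m (bℚ ∘ f ∘ Fin.suc) ≤ 1ℚ
  tail≤1 = ≤-trans (≤-trans (≤-reflexive (sym (+-identityˡ _))) (+-monoˡ-≤ _ (0≤bℚ (f Fin.zero)))) Σ≤1

masked-sum≤ : ∀ {m} b (J y : Fin m → Bool) → sumFin m (bℚ ∘ y) ≤ 1ℚ →
              sumFin m (λ c → bℚ (b ∧ J c) * bℚ (y c)) ≤ bℚ b
masked-sum≤ false J y Σ≤1 = ≤-reflexive (sumFin-zero λ c → *-zeroˡ (bℚ (y c)))
masked-sum≤ true  J y Σ≤1 = ≤-trans (sumFin-mono term≤) Σ≤1
  where
  term≤ : ∀ c → bℚ (J c) * bℚ (y c) ≤ bℚ (y c)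
  term≤ c with J c
  ... | true  = ≤-reflexive (*-identityˡ (bℚ (y c)))
  ... | false = ≤-trans (≤-reflexive (*-zeroˡ (bℚ (y c)))) (0≤bℚ (y c))

masked-sum-gap : ∀ {m} (J y : Fin m → Bool) → (∀ c → (J c ∧ y c) ≡ false) →
                 sumFin m (λ c → bℚ (true ∧ J c) * bℚ (y c)) + 1ℚ ≤ 1ℚ
masked-sum-gap J y disjoint = ≤-reflexive (trans (cong (_+ 1ℚ) (sumFin-zero term≡0)) (+-identityˡ 1ℚ))
  where
  term≡0 : ∀ c → bℚ (J c) * bℚ (y c) ≡ 0ℚ
  term≡0 c with J c | disjoint c
  ... | true  | yc≡false = trans (cong (λ b → 1ℚ * bℚ b) yc≡false) (*-zeroˡ 1ℚ)
  ... | false | _        = *-zeroˡ (bℚ (y c))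

+-mono-+1ˡ : ∀ {a b A B} → a + 1ℚ ≤ A → b ≤ B → (a + b) + 1ℚ ≤ A + B
+-mono-+1ˡ {a} {b} a+1≤A b≤B = begin
  (a + b) + 1ℚ  ≡⟨ +-assoc a b 1ℚ ⟩
  a + (b + 1ℚ)  ≡⟨ cong (a +_) (+-comm b 1ℚ) ⟩
  a + (1ℚ + b)  ≡⟨ sym (+-assoc a 1ℚ b) ⟩
  (a + 1ℚ) + b  ≤⟨ +-mono-≤ a+1≤A b≤B ⟩
  _             ∎
  where open ≤-Reasoning

+-mono-+1ʳ : ∀ {a b A B} → a ≤ A → b + 1ℚ ≤ B → (a + b) + 1ℚ ≤ A + B
+-mono-+1ʳ {a} {b} a≤A b+1≤B = ≤-trans (≤-reflexive (+-assoc a b 1ℚ)) (+-mono-≤ a≤A b+1≤B)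

anyFin-intro : ∀ {m} (f : Fin m → Bool) {j} → f j ≡ true → anyFin m f ≡ true
anyFin-intro {suc m} f {Fin.zero}  fj rewrite fj = refl
anyFin-intro {suc m} f {Fin.suc j} fj with f Fin.zero
... | true  = refl
... | false = anyFin-intro (f ∘ Fin.suc) fj

_⊆_ : ∀ {m} → (Fin m → Bool) → (Fin m → Bool) → Set
f ⊆ g = ∀ x → f x ≡ true → g x ≡ true

⊆-false : ∀ {m} {f g : Fin m → Bool} → f ⊆ g → ∀ {x} → g x ≡ false → f x ≡ false
⊆-false {f = f} f⊆g {x} gx≡false = ¬-not λ fx → contradiction (trans (sym (f⊆g x fx)) gx≡false) λ ()

countFin-mono : ∀ {m} {f g : Fin m → Bool} → f ⊆ g → countFin m f ℕ.≤ countFin m g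
countFin-mono {ℕ.zero}  f⊆g = ℕ.z≤n
countFin-mono {suc m} {f} {g} f⊆g with f Fin.zero in f₀ | g Fin.zero in g₀
... | true  | true  = ℕ.s≤s (countFin-mono (f⊆g ∘ Fin.suc))
... | true  | false = contradiction (trans (sym (f⊆g Fin.zero f₀)) g₀) λ ()
... | false | true  = ℕP.m≤n⇒m≤1+n (countFin-mono (f⊆g ∘ Fin.suc))
... | false | false = countFin-mono (f⊆g ∘ Fin.suc)

countFin-< : ∀ {m} {f g : Fin m → Bool} → f ⊆ g → ∀ {z} → f z ≡ false → g z ≡ true →
             countFin m f ℕ.< countFin m g
countFin-< {suc m} {f} {g} f⊆g {Fin.zero} fz gz rewrite fz | gz = ℕ.s≤s (countFin-mono (f⊆g ∘ Fin.suc))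
countFin-< {suc m} {f} {g} f⊆g {Fin.suc z} fz gz with f Fin.zero in f₀ | g Fin.zero in g₀
... | true  | true  = ℕ.s≤s (countFin-< (f⊆g ∘ Fin.suc) fz gz)
... | true  | false = contradiction (trans (sym (f⊆g Fin.zero f₀)) g₀) λ ()
... | false | true  = ℕP.m≤n⇒m≤1+n (countFin-< (f⊆g ∘ Fin.suc) fz gz)
... | false | false = countFin-< (f⊆g ∘ Fin.suc) fz gz

module Combinations {n : ℕ} (G : Graph n) (k : ℕ) (w : Fin n → ℚ) where

  Combination : Set
  Combination = List (ℚ × BinPoint G k w)

  ∑ : Combination → (ℚ → BinPoint G k w → ℚ) → ℚ
  ∑ = sumList G k w

  toPoint : BinPoint G k w → Point G k w
  toPoint y v i = bℚ (y v i)

  PreservesCombinations : (Point G k w → ℚ) → Set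
  PreservesCombinations L = ∀ cs x → (∀ v i → x v i ≡ ∑ cs (λ l y → l * toPoint y v i)) →
                            L x ≡ ∑ cs (λ l y → l * L (toPoint y))

  ∑-cong : ∀ cs {f g : ℚ → BinPoint G k w → ℚ} → (∀ l y → f l y ≡ g l y) → ∑ cs f ≡ ∑ cs g
  ∑-cong []             f≡g = refl
  ∑-cong ((l , y) ∷ cs) f≡g = cong₂ _+_ (f≡g l y) (∑-cong cs f≡g)

  ∑-zero : ∀ cs → ∑ cs (λ _ _ → 0ℚ) ≡ 0ℚ
  ∑-zero []       = refl
  ∑-zero (_ ∷ cs) = trans (cong (0ℚ +_) (∑-zero cs)) (+-identityˡ 0ℚ)

  ∑-+ : ∀ cs f g → ∑ cs (λ l y → f l y + g l y) ≡ ∑ cs f + ∑ cs g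
  ∑-+ []             f g = sym (+-identityˡ 0ℚ)
  ∑-+ ((l , y) ∷ cs) f g =
    trans (cong (f l y + g l y +_) (∑-+ cs f g)) (+-interchange (f l y) (g l y) (∑ cs f) (∑ cs g))

  ∑-*ˡ : ∀ cs c f → ∑ cs (λ l y → c * f l y) ≡ c * ∑ cs f
  ∑-*ˡ []             c f = sym (*-zeroʳ c)
  ∑-*ˡ ((l , y) ∷ cs) c f =
    trans (cong (c * f l y +_) (∑-*ˡ cs c f)) (sym (*-distribˡ-+ c (f l y) (∑ cs f)))

  sumFin-∑ : ∀ {m} cs (F : Fin m → ℚ → BinPoint G k w → ℚ) →
             sumFin m (λ j → ∑ cs (F j)) ≡ ∑ cs (λ l y → sumFin m (λ j → F j l y))
  sumFin-∑ {ℕ.zero}  cs F = sym (∑-zero cs)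
  sumFin-∑ {suc m} cs F = trans (cong (∑ cs (F Fin.zero) +_) (sumFin-∑ cs (F ∘ Fin.suc)))
    (sym (∑-+ cs (F Fin.zero) (λ l y → sumFin m (λ j → F (Fin.suc j) l y))))

  coordinate-preserves : ∀ v i → PreservesCombinations (λ x → x v i)
  coordinate-preserves v i cs x x≡∑ = x≡∑ v i

  +-preserves : ∀ {L L′} → PreservesCombinations L → PreservesCombinations L′ →
                PreservesCombinations (λ x → L x + L′ x)
  +-preserves {L} {L′} pL pL′ cs x x≡∑ = begin
    L x + L′ x
      ≡⟨ cong₂ _+_ (pL cs x x≡∑) (pL′ cs x x≡∑) ⟩
    ∑ cs (λ l y → l * L (toPoint y)) + ∑ cs (λ l y → l * L′ (toPoint y))
      ≡⟨ sym (∑-+ cs _ _) ⟩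
    ∑ cs (λ l y → l * L (toPoint y) + l * L′ (toPoint y))
      ≡⟨ ∑-cong cs (λ l y → sym (*-distribˡ-+ l _ _)) ⟩
    ∑ cs (λ l y → l * (L (toPoint y) + L′ (toPoint y))) ∎
    where open ≡-Reasoning

  *-preserves : ∀ c {L} → PreservesCombinations L → PreservesCombinations (λ x → c * L x)
  *-preserves c {L} pL cs x x≡∑ = begin
    c * L x                                   ≡⟨ cong (c *_) (pL cs x x≡∑) ⟩
    c * ∑ cs (λ l y → l * L (toPoint y))      ≡⟨ sym (∑-*ˡ cs c _) ⟩
    ∑ cs (λ l y → c * (l * L (toPoint y)))    ≡⟨ ∑-cong cs (λ l y → *-leftSwap c l _) ⟩
    ∑ cs (λ l y → l * (c * L (toPoint y)))    ∎
    where open ≡-Reasoning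

  sumFin-preserves : ∀ {m} {L : Fin m → Point G k w → ℚ} → (∀ j → PreservesCombinations (L j)) →
                     PreservesCombinations (λ x → sumFin m (λ j → L j x))
  sumFin-preserves {m} {L} pL cs x x≡∑ = begin
    sumFin m (λ j → L j x)                                ≡⟨ sumFin-cong (λ j → pL j cs x x≡∑) ⟩
    sumFin m (λ j → ∑ cs (λ l y → l * L j (toPoint y)))   ≡⟨ sumFin-∑ {m} cs _ ⟩
    ∑ cs (λ l y → sumFin m (λ j → l * L j (toPoint y)))   ≡⟨ ∑-cong cs (λ l y → sumFin-*ˡ {m} l _) ⟩
    ∑ cs (λ l y → l * sumFin m (λ j → L j (toPoint y)))   ∎
    where open ≡-Reasoning

  ∑-convex-≤ : ∀ R (a : BinPoint G k w → ℚ) cs →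
               All (λ c → 0ℚ ≤ proj₁ c × Feasible G k w (proj₂ c)) cs → ∑ cs (λ l _ → l) ≡ 1ℚ →
               (∀ y → Feasible G k w y → a y ≤ R) → ∑ cs (λ l y → l * a y) ≤ R
  ∑-convex-≤ R a cs weights ∑l≡1 a≤R = begin
    ∑ cs (λ l y → l * a y)  ≤⟨ termwise cs weights ⟩
    ∑ cs (λ l _ → l * R)    ≡⟨ ∑-cong cs (λ l _ → *-comm l R) ⟩
    ∑ cs (λ l _ → R * l)    ≡⟨ ∑-*ˡ cs R (λ l _ → l) ⟩
    R * ∑ cs (λ l _ → l)    ≡⟨ cong (R *_) ∑l≡1 ⟩
    R * 1ℚ                  ≡⟨ *-identityʳ R ⟩
    R                       ∎
    where
    open ≤-Reasoning
    termwise : ∀ cs → All (λ c → 0ℚ ≤ proj₁ c × Feasible G k w (proj₂ c)) cs →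
               ∑ cs (λ l y → l * a y) ≤ ∑ cs (λ l _ → l * R)
    termwise []             []                  = ≤-refl
    termwise ((l , y) ∷ cs) ((0≤l , fy) ∷ rest) =
      +-mono-≤ (*-monoˡ-≤-nonNeg l {{nonNegative 0≤l}} (a≤R y fy)) (termwise cs rest)

  validFor-fromBinary : ∀ {L} R → PreservesCombinations L →
                        (∀ y → Feasible G k w y → L (toPoint y) ≤ R) → ValidFor G k w L R
  validFor-fromBinary {L} R pL bound x (cs , weights , ∑l≡1 , x≡∑) =
    subst (_≤ R) (sym (pL cs x x≡∑)) (∑-convex-≤ R (L ∘ toPoint) cs weights ∑l≡1 bound)

module Connectivity {n : ℕ} (G : Graph n) where

  WalkIn : VSet n → Fin n → Fin n → Set
  WalkIn X u v = ∃ λ ws → Chain G u v ws × All (λ z → X z ≡ true) ws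

  SeparatorInequality : VSet n → Set
  SeparatorInequality X = ∀ u v → u ≢ v → adj G u v ≡ false → ∀ S → IsMinimalSeparator G u v S →
    (bℚ (X u) + bℚ (X v)) - sumFin n (λ z → bℚ (S z ∧ X z)) ≤ 1ℚ

  separator-mono : ∀ {u v T T′} → IsSeparator G u v T → T ⊆ T′ → T′ u ≡ false → T′ v ≡ false →
                   IsSeparator G u v T′
  separator-mono (_ , _ , noWalk) T⊆T′ T′u T′v =
    T′u , T′v , λ (ws , chain , avoidsT′) → noWalk (ws , chain , All.map (⊆-false T⊆T′) avoidsT′)

  _∖_ : VSet n → Fin n → VSet n
  (T ∖ z) x = T x ∧ not ⌊ x ≟ z ⌋

  ∖-⊆ : ∀ T z → (T ∖ z) ⊆ T
  ∖-⊆ T z x e with T x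
  ... | true  = refl
  ... | false = e

  ∖-self : ∀ T z → (T ∖ z) z ≡ false
  ∖-self T z with z ≟ z
  ... | yes _  = ∧-zeroʳ (T z)
  ... | no z≢z = contradiction refl z≢z

  ∖-false : ∀ T z {x} → T x ≡ false → (T ∖ z) x ≡ false
  ∖-false T z Tx rewrite Tx = refl

  ⊆-∖ : ∀ {T T′} z → T′ ⊆ T → T′ z ≡ false → T′ ⊆ (T ∖ z)
  ⊆-∖ z T′⊆T T′z x T′x with x ≟ z
  ... | yes refl = contradiction (trans (sym T′x) T′z) λ ()
  ... | no _ rewrite T′⊆T x T′x = refl

  MinimalSeparatorWithin : Fin n → Fin n → VSet n → Set
  MinimalSeparatorWithin u v T = Σ (VSet n) λ S → IsMinimalSeparator G u v S × S ⊆ T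

  -- Induction on |T|: either some vertex of T can be dropped, or T is minimal; the case split
  -- is classical, hence the double negation.
  ¬¬minimalSeparatorWithin : ∀ {u v} T → IsSeparator G u v T → ¬ ¬ MinimalSeparatorWithin u v T
  ¬¬minimalSeparatorWithin {u} {v} T = <-rec P shrink (countFin n T) T refl
    where
    Shrinkable : VSet n → Set
    Shrinkable T = Σ (Fin n) λ z → T z ≡ true × IsSeparator G u v (T ∖ z)

    P : ℕ → Set
    P m = ∀ T → countFin n T ≡ m → IsSeparator G u v T → ¬ ¬ MinimalSeparatorWithin u v T

    minimal : ∀ {T} → IsSeparator G u v T → ¬ Shrinkable T → IsMinimalSeparator G u v T
    minimal {T} sepT@(Tu , Tv , _) unshrinkable =
      sepT , λ T′ T′⊆T sepT′ z Tz → ¬-not λ T′z≡false → unshrinkable (z , Tz ,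
        separator-mono sepT′ (⊆-∖ z T′⊆T T′z≡false) (∖-false T z Tu) (∖-false T z Tv))

    shrink : ∀ m → (∀ {m′} → m′ ℕ.< m → P m′) → P m
    shrink _ smaller T refl sepT = ¬¬-excluded-middle {A = Shrinkable T} >>= λ where
      (yes (z , Tz , sepT∖z)) →
        (λ (S , minS , S⊆T∖z) → S , minS , λ x Sx → ∖-⊆ T z x (S⊆T∖z x Sx))
          <$> smaller (countFin-< (∖-⊆ T z) (∖-self T z) Tz) (T ∖ z) refl sepT∖z
      (no unshrinkable) → pure (T , minimal sepT unshrinkable , λ _ Tx → Tx)

  ¬2-0≤1 : ∀ {a b s} → a ≡ true → b ≡ true → s ≡ 0ℚ → ¬ ((bℚ a + bℚ b) - s ≤ 1ℚ)
  ¬2-0≤1 refl refl refl = ≤⇒≤ᵇ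

  ¬¬walkIn : ∀ {X u v} → SeparatorInequality X → u ≢ v → X u ≡ true → X v ≡ true → ¬ ¬ WalkIn X u v
  ¬¬walkIn {X} {u} {v} ineq u≢v Xu Xv noWalk with adj G u v in uv
  ... | true  = noWalk (v ∷ [] , (uv , refl) , Xv ∷ [])
  ... | false = ¬¬minimalSeparatorWithin (not ∘ X) complementSeparates
      λ (S , minS , S⊆∁X) → ¬2-0≤1 Xu Xv (sumFin-zero (meetsX≡0 S⊆∁X)) (ineq u v u≢v uv S minS)
    where
    complementSeparates : IsSeparator G u v (not ∘ X)
    complementSeparates = cong not Xu , cong not Xv ,
      λ (ws , chain , avoids) → noWalk (ws , chain , All.map not-injective avoids)
    meetsX≡0 : ∀ {S} → S ⊆ (not ∘ X) → ∀ z → bℚ (S z ∧ X z) ≡ 0ℚ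
    meetsX≡0 {S} S⊆∁X z with S z in Sz
    ... | true  = cong bℚ (not-injective (S⊆∁X z Sz))
    ... | false = refl

  walk-staysIn : ∀ (S X : VSet n) {a v ws} → Chain G a v ws → S a ≡ true → All (λ z → X z ≡ true) ws →
                 (∀ z → X z ≡ true → nbhd G S z ≡ false) → All (λ z → S z ≡ true) ws
  walk-staysIn S X {ws = []}     _            _  []         _         = []
  walk-staysIn S X {ws = w ∷ ws} (aw , chain) Sa (Xw ∷ Xws) X∩N≡∅ with S w in Sw
  ... | true  = Sw ∷ walk-staysIn S X chain Sw Xws X∩N≡∅
  ... | false = contradiction (trans (sym w∈N) (X∩N≡∅ w Xw)) λ ()
    where
    w∈N : nbhd G S w ≡ true
    w∈N = cong₂ _∧_ (cong not Sw) (anyFin-intro (λ z → S z ∧ adj G z w) (cong₂ _∧_ Sa aw))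

  open DecMembership (_≟_ {n}) using (_∈?_)

  chain-suffix : ∀ {a u v ws} → Chain G a v ws → Unique ws → u ∈ ws →
                 Σ (List (Fin n)) λ ws′ → Chain G u v ws′ × Unique (u ∷ ws′) × ws′ List.⊆ ws
  chain-suffix {ws = _ ∷ ws} (_ , chain) unique (here refl) = ws , chain , unique , there
  chain-suffix {ws = _ ∷ ws} (_ , chain) (_ ∷ unique) (there u∈ws)
    with chain-suffix chain unique u∈ws
  ... | ws′ , chain′ , unique′ , ws′⊆ws = ws′ , chain′ , unique′ , there ∘ ws′⊆ws

  -- Loop erasure: whenever the walk returns to its start, cut it there.
  walk⇒path : ∀ {u v ws} → Chain G u v ws →
              Σ (List (Fin n)) λ ws′ → Chain G u v ws′ × Unique (u ∷ ws′) × ws′ List.⊆ ws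
  walk⇒path {ws = []} chain = [] , chain , [] ∷ [] , λ ()
  walk⇒path {u} {ws = w ∷ ws} (uw , chain) with walk⇒path chain
  ... | ws′ , chain′ , unique , ws′⊆ws with u ∈? (w ∷ ws′)
  ...   | no u∉ = w ∷ ws′ , (uw , chain′) , ¬Any⇒All¬ (w ∷ ws′) u∉ ∷ unique , ∷⁺ʳ w ws′⊆ws
  ...   | yes u∈ with chain-suffix (uw , chain′) unique u∈
  ...     | ws″ , chain″ , unique″ , ws″⊆w∷ws′ = ws″ , chain″ , unique″ , ∷⁺ʳ w ws′⊆ws ∘ ws″⊆w∷ws′

module Inequality {n : ℕ} (G : Graph n) (k : ℕ) (w : Fin n → ℚ) (q : ℕ) (S : VSet n)
                  (s t : Fin q → Fin n) (σ : Fin q → Fin k) where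

  open Combinations G k w
  open Connectivity G

  outsideI : Fin k → Bool
  outsideI c = not (anyFin q (λ j → ⌊ σ j ≟ c ⌋))

  lhs : Point G k w → ℚ
  lhs x = sumFin q (λ i → x (s i) (σ i) + x (t i) (σ i))
        + sumFin n (λ v → sumFin k (λ c → bℚ (nbhd G S v ∧ outsideI c) * x v c))

  rhs : ℚ
  rhs = ℕtoℚ (2 ℕ.* q ℕ.+ countFin n (nbhd G S)) - 1ℚ

  lhs-preserves : PreservesCombinations lhs
  lhs-preserves = +-preserves
    (sumFin-preserves λ i → +-preserves (coordinate-preserves (s i) (σ i)) (coordinate-preserves (t i) (σ i)))
    (sumFin-preserves λ v → sumFin-preserves λ c → *-preserves (bℚ (nbhd G S v ∧ outsideI c)) (coordinate-preserves v c))

  σ∉outsideI : ∀ i → outsideI (σ i) ≡ false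
  σ∉outsideI i = cong not (anyFin-intro (λ j → ⌊ σ j ≟ σ i ⌋)
    (trans (isYes≗does (σ i ≟ σ i)) (dec-true (σ i ≟ σ i) refl)))

  maxLhs : ℚ
  maxLhs = sumFin q (λ _ → 1ℚ + 1ℚ) + sumFin n (bℚ ∘ nbhd G S)

  maxLhs-1≡rhs : maxLhs - 1ℚ ≡ rhs
  maxLhs-1≡rhs = cong (_- 1ℚ) (begin
    sumFin q (λ _ → 1ℚ + 1ℚ) + sumFin n (bℚ ∘ nbhd G S)
      ≡⟨ cong₂ _+_ (sumFin-+ {q} (λ _ → 1ℚ) (λ _ → 1ℚ)) (sumFin-bℚ (nbhd G S)) ⟩
    (sumFin q (λ _ → 1ℚ) + sumFin q (λ _ → 1ℚ)) + ℕtoℚ (countFin n (nbhd G S))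
      ≡⟨ cong (_+ _) (cong₂ _+_ (sumFin-1 q) (sumFin-1 q)) ⟩
    (ℕtoℚ q + ℕtoℚ q) + ℕtoℚ (countFin n (nbhd G S))
      ≡⟨ cong (λ m → (ℕtoℚ q + ℕtoℚ m) + _) (sym (ℕP.+-identityʳ q)) ⟩
    (ℕtoℚ q + ℕtoℚ (q ℕ.+ 0)) + ℕtoℚ (countFin n (nbhd G S))
      ≡⟨ sym (trans (ℕtoℚ-+ (2 ℕ.* q) _) (cong (_+ _) (ℕtoℚ-+ q (q ℕ.+ 0)))) ⟩
    ℕtoℚ (2 ℕ.* q ℕ.+ countFin n (nbhd G S)) ∎)
    where open ≡-Reasoning

  module BinaryPoint (y : BinPoint G k w) (oneColour : ∀ v → sumFin k (λ c → bℚ (y v c)) ≤ 1ℚ) where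

    gap⇒bound : lhs (toPoint y) + 1ℚ ≤ maxLhs → lhs (toPoint y) ≤ rhs
    gap⇒bound gap = subst (lhs (toPoint y) ≤_) maxLhs-1≡rhs (+1≤⇒≤-1 gap)

    pairTerm : Fin q → ℚ
    pairTerm i = bℚ (y (s i) (σ i)) + bℚ (y (t i) (σ i))

    neighbourTerm : Fin n → ℚ
    neighbourTerm v = sumFin k (λ c → bℚ (nbhd G S v ∧ outsideI c) * bℚ (y v c))

    pair≤2 : ∀ i → pairTerm i ≤ 1ℚ + 1ℚ
    pair≤2 i = +-mono-≤ (bℚ≤1 (y (s i) (σ i))) (bℚ≤1 (y (t i) (σ i)))

    neighbour≤1 : ∀ v → neighbourTerm v ≤ bℚ (nbhd G S v)
    neighbour≤1 v = masked-sum≤ (nbhd G S v) outsideI (y v) (oneColour v)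

    pairGap : ∀ i → y (s i) (σ i) ≡ false ⊎ y (t i) (σ i) ≡ false → lhs (toPoint y) + 1ℚ ≤ maxLhs
    pairGap i uncoloured = +-mono-+1ˡ {sumFin q pairTerm} {sumFin n neighbourTerm}
      (sumFin-mono-+1 pair≤2 i (bℚ-+-gap (y (s i) (σ i)) (y (t i) (σ i)) uncoloured))
      (sumFin-mono neighbour≤1)

    neighbourGap : ∀ v → nbhd G S v ≡ true → (∀ c → (outsideI c ∧ y v c) ≡ false) →
                   lhs (toPoint y) + 1ℚ ≤ maxLhs
    neighbourGap v v∈N onlyInI = +-mono-+1ʳ {sumFin q pairTerm} {sumFin n neighbourTerm} (sumFin-mono pair≤2)
      (sumFin-mono-+1 neighbour≤1 v
        (subst (λ b → sumFin k (λ c → bℚ (b ∧ outsideI c) * bℚ (y v c)) + 1ℚ ≤ bℚ b) (sym v∈N)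
          (masked-sum-gap outsideI (y v) onlyInI)))

  PathsInColourClasses : BinPoint G k w → Set
  PathsInColourClasses y = ∀ i → Σ (List (Fin n)) λ P → IsPathIn G S (s i) (t i) P × All (λ z → y z (σ i) ≡ true) P

  module Violation (s≢t : ∀ i → s i ≢ t i) (endsInS : ∀ i → S (s i) ≡ true × S (t i) ≡ true)
                   (y : BinPoint G k w) (feasible : Feasible G k w y) (violated : ¬ lhs (toPoint y) ≤ rhs) where

    oneColour : ∀ v → sumFin k (λ c → bℚ (y v c)) ≤ 1ℚ
    oneColour = proj₁ (proj₂ feasible)
    open BinaryPoint y oneColour

    s-coloured : ∀ i → y (s i) (σ i) ≡ true
    s-coloured i = ¬-not λ uncoloured → violated (gap⇒bound (pairGap i (inj₁ uncoloured)))

    t-coloured : ∀ i → y (t i) (σ i) ≡ true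
    t-coloured i = ¬-not λ uncoloured → violated (gap⇒bound (pairGap i (inj₂ uncoloured)))

    class-avoids-N : ∀ i z → y z (σ i) ≡ true → nbhd G S z ≡ false
    class-avoids-N i z yzσi = ¬-not λ z∈N → violated (gap⇒bound (neighbourGap z z∈N onlyInI))
      where
      onlyInI : ∀ c → (outsideI c ∧ y z c) ≡ false
      onlyInI c with y z c in yzc
      ... | false = ∧-zeroʳ (outsideI c)
      ... | true with sumFin-bℚ≤1⇒unique (y z) (oneColour z) yzc yzσi
      ...   | refl rewrite σ∉outsideI i = refl

    ¬¬pathsInColourClasses : ¬ ¬ PathsInColourClasses y
    ¬¬pathsInColourClasses = ¬¬-∀-Fin q λ i →
      path i <$> ¬¬walkIn (λ u v u≢v uv T minT → proj₂ (proj₂ feasible) u v u≢v uv T minT (σ i))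
                          (s≢t i) (s-coloured i) (t-coloured i)
      where
      path : ∀ i → WalkIn (λ z → y z (σ i)) (s i) (t i) →
             Σ (List (Fin n)) λ P → IsPathIn G S (s i) (t i) P × All (λ z → y z (σ i) ≡ true) P
      path i (ws , walk , inClass) with walk⇒path walk
      ... | ws′ , path′ , unique , ws′⊆ws =
        s i ∷ ws′ , (refl , path′ , unique , s∈S ∷ walk-staysIn S _ path′ s∈S inClass′ (class-avoids-N i)) ,
        s-coloured i ∷ inClass′
        where
        s∈S : S (s i) ≡ true
        s∈S = proj₁ (endsInS i)
        inClass′ : All (λ z → y z (σ i) ≡ true) ws′
        inClass′ = anti-mono ws′⊆ws inClass

    classes-disjoint : Injective _≡_ _≡_ σ → ∀ (P : PathsInColourClasses y) i j → i ≢ j →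
                       ∀ z → z ∈ proj₁ (P i) → z ∈ proj₁ (P j) → ⊥
    classes-disjoint σ-injective P i j i≢j z z∈Pi z∈Pj = i≢j (σ-injective
      (sumFin-bℚ≤1⇒unique (y z) (oneColour z)
        (All.lookup (proj₂ (proj₂ (P i))) z∈Pi) (All.lookup (proj₂ (proj₂ (P j))) z∈Pj)))

  binaryBound : (∀ i → s i ≢ t i) → (∀ i → S (s i) ≡ true × S (t i) ≡ true) → Injective _≡_ _≡_ σ →
                ¬ (Σ (Fin q → List (Fin n)) λ P →
                     (∀ i → IsPathIn G S (s i) (t i) (P i)) × (∀ i j → i ≢ j → ∀ z → z ∈ P i → z ∈ P j → ⊥)) →
                ∀ y → Feasible G k w y → lhs (toPoint y) ≤ rhs
  -- ≤ on ℚ is decidable, so refuting a violation suffices.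
  binaryBound s≢t endsInS σ-injective noDisjointPaths y feasible =
    decidable-stable (lhs (toPoint y) ≤? rhs) λ violated →
      let open Violation s≢t endsInS y feasible violated in
      ¬¬pathsInColourClasses λ P → noDisjointPaths
        ((λ i → proj₁ (P i)) , (λ i → proj₁ (proj₂ (P i))) , classes-disjoint σ-injective P)

mainTheorem3 :
    (k : ℕ) → k ≥ 1 →
    {n : ℕ} (G : Graph n) → Connected G →
    (w : Fin n → ℚ) → (∀ v → 0ℚ < w v) →
    (q : ℕ) → q ≥ 2 →
    (S : VSet n) →
    (s t : Fin q → Fin n) →
    (∀ i → s i ≢ t i) →
    (∀ i → S (s i) ≡ true × S (t i) ≡ true) →
    (∀ i j → i ≢ j → ¬ ((s i ≡ s j × t i ≡ t j) ⊎ (s i ≡ t j × t i ≡ s j))) →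
    (σ : Fin q → Fin k) → Injective _≡_ _≡_ σ →
    ¬ (Σ (Fin q → List (Fin n)) λ P →
         (∀ i → IsPathIn G S (s i) (t i) (P i)) ×
         (∀ i j → i ≢ j → ∀ z → z ∈ P i → z ∈ P j → ⊥)) →
    ValidFor G k w
      (λ x → sumFin q (λ i → x (s i) (σ i) + x (t i) (σ i))
             + sumFin n (λ v → sumFin k (λ i →
                 bℚ (nbhd G S v ∧ not (anyFin q (λ j → ⌊ σ j ≟ i ⌋))) * x v i)))
      (ℕtoℚ (2 ℕ.* q ℕ.+ countFin n (nbhd G S)) - 1ℚ)
mainTheorem3 k _ G _ w _ q _ S s t s≢t endsInS _ σ σ-injective noDisjointPaths =
  validFor-fromBinary rhs lhs-preserves (binaryBound s≢t endsInS σ-injective noDisjointPaths)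
  where
  open Combinations G k w
  open Inequality G k w q S s t σ
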